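{- For every integer $e\ge4$ there exists a non-decreasing pure $O$-sequence $(h_0,\dots,h_e)$ of socle degree $e$ that is not differentiable.
   Context: For positive integers $n,d$, write $n=\binom{k_d}{d}+\cdots+\binom{k_\delta}{\delta}$ with $k_d>\dots>k_\delta\ge\delta\ge1$ (unique $d$-binomial expansion) and set $(n_{(d)})^1_1=\binom{k_d+1}{d+1}+\cdots+\binom{k_\delta+1}{\delta+1}$; set $(0_{(d)})^1_1=0$. A sequence $(h_0,\dots,h_e)$ of non-negative integers with $h_0=1$ is an $O$-sequence if $h_{d+1}\le((h_d)_{(d)})^1_1$ for all $1\le d<e$. A monomial order ideal is a finite nonempty set of monomials closed under taking divisors; it is pure if all its maximal monomials under divisibility have the same degree $e$, the socle degree. A pure $O$-sequence is the vector counting the monomials of each degree $0,\dots,e$ in a pure monomial order ideal. A sequence is non-decreasing if $h_{i+1}\ge h_i$ for all $i$, and differentiable if $(h_0,h_1-h_0,\dots,h_e-h_{e-1})$ is an $O$-sequence. -}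

module Defs where

open import Data.Nat using (ℕ; zero; suc; _+_; _∸_; _≤_; _<_; _≤?_; _≟_)
open import Data.Bool using (if_then_else_)
open import Data.List using (List; []; _∷_; length; filter; map; upTo)
open import Data.List.Membership.Propositional using (_∈_)
open import Data.List.Relation.Unary.Unique.Propositional using (Unique)
open import Data.Vec using (Vec)
import Data.Vec as Vec
open import Data.Vec.Relation.Binary.Pointwise.Inductive using (Pointwise)
open import Data.Product using (Σ; _×_)
open import Relation.Binary.PropositionalEquality using (_≡_; _≢_)
open import Relation.Nullary using (¬_; does)

choose : ℕ → ℕ → ℕ
choose _       zero    = 1
choose zero    (suc d) = 0
choose (suc k) (suc d) = choose k d + choose k (suc d)

lastK : ℕ → ℕ → ℕ → ℕ
lastK d n zero    = zero
lastK d n (suc m) = if does (choose (suc m) d ≤? n) then suc m else lastK d n m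

-- (n_(d))^1_1 computed from the greedy (= unique) d-binomial expansion
-- n = C(k_d,d) + ... + C(k_δ,δ); each top coefficient k_d is the largest k
-- with C(k,d) ≤ n (k ≤ n + d always suffices).
macaulay : ℕ → ℕ → ℕ
macaulay zero    n = 0
macaulay (suc d) zero = 0
macaulay (suc d) (suc n) =
  let k = lastK (suc d) (suc n) (suc n + suc d) in
  choose (suc k) (suc (suc d)) + macaulay d (suc n ∸ choose k (suc d))

-- i-th entry of a sequence (0 outside the range; only used in range)
at : List ℕ → ℕ → ℕ
at []       _       = 0
at (x ∷ _)  zero    = x
at (_ ∷ xs) (suc i) = at xs i

OSequence : List ℕ → Set
OSequence h = (at h 0 ≡ 1) ×
  (∀ d → 1 ≤ d → suc d < length h → at h (suc d) ≤ macaulay d (at h d))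

NonDecreasing : List ℕ → Set
NonDecreasing h = ∀ i → suc i < length h → at h i ≤ at h (suc i)

diffSeq : List ℕ → List ℕ
diffSeq []           = []
diffSeq (x ∷ xs)     = x ∷ go x xs
  where
  go : ℕ → List ℕ → List ℕ
  go _ []       = []
  go p (y ∷ ys) = (y ∸ p) ∷ go y ys

-- differentiable: the differences are non-negative integers (non-decreasing)
-- and form an O-sequence
Differentiable : List ℕ → Set
Differentiable h = NonDecreasing h × OSequence (diffSeq h)

Monomial : ℕ → Set
Monomial r = Vec ℕ r

deg : ∀ {r} → Monomial r → ℕ
deg = Vec.sum

_∣ₘ_ : ∀ {r} → Monomial r → Monomial r → Set
m ∣ₘ m' = Pointwise _≤_ m m'

record OrderIdeal {r : ℕ} (L : List (Monomial r)) : Set where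
  field
    unique   : Unique L
    nonempty : L ≢ []
    closed   : ∀ {m m'} → m ∈ L → m' ∣ₘ m → m' ∈ L

Maximal : ∀ {r} → List (Monomial r) → Monomial r → Set
Maximal L m = (m ∈ L) × (∀ {m'} → m' ∈ L → m ∣ₘ m' → m' ≡ m)

PureOrderIdeal : ∀ {r} → ℕ → List (Monomial r) → Set
PureOrderIdeal e L = OrderIdeal L × (∀ m → Maximal L m → deg m ≡ e)

countDeg : ∀ {r} → List (Monomial r) → ℕ → ℕ
countDeg L i = length (filter (λ m → deg m ≟ i) L)

PureOSequence : ℕ → List ℕ → Set
PureOSequence e h = Σ ℕ λ r → Σ (List (Monomial r)) λ L →
  PureOrderIdeal e L × (h ≡ map (countDeg L) (upTo (suc e)))

module Submission where

-- For n = e - 2 ≥ 2 take, in the five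
-- variables x, y, z, u, v, the order ideal
--     I = { x^a y^b z^c : a + b + c ≤ e }  ∪  { u^s v^t ≠ 1 : s ≤ n, t ≤ 2 }.
-- Its maximal monomials are the x,y,z-monomials of degree e and u^n v^2, so I
-- is pure of socle degree e.  In degree i the first part contributes
-- F(i) = #monomials of degree i in three variables, with F(i+1) = F(i) + i + 2,
-- and the box contributes a number B(i) ≤ 3 of monomials which falls from 3 to 2
-- to 1 in degrees n, n+1, n+2.  Hence h = (F(i) + B(i))ᵢ is non-decreasing, and
-- wherever B falls by one the first difference equals the degree, so
-- Δh(n+1) = n+1 and Δh(n+2) = n+2.  Since n+1 ≤ n+1 is its own Macaulay bound
-- in degree n+1, Δh violates Macaulay's inequality and h is not differentiable.

open import Defs
open import Data.Nat
open import Data.Nat.Properties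
open import Data.Nat.Tactic.RingSolver using (solve-∀)
open import Data.List using (List; []; _∷_; length; filter; map; upTo; applyUpTo; _++_)
open import Data.List.Properties
  using (length-map; length-++; length-filter; length-upTo; filter-all; filter-none;
         filter-++; filter-accept; filter-reject; map-upTo)
open import Data.List.Membership.Propositional using (_∈_)
open import Data.List.Membership.Propositional.Properties
  using (∈-map⁺; ∈-map⁻; ∈-++⁺ˡ; ∈-++⁺ʳ; ∈-++⁻; ∈-filter⁺; ∈-filter⁻; ∈-upTo⁺; ∈-upTo⁻)
open import Data.List.Relation.Unary.Any using (here)
import Data.List.Relation.Unary.All as All
open import Data.List.Relation.Unary.Unique.Propositional using (Unique)
open import Data.List.Relation.Unary.AllPairs using ([]; _∷_)
import Data.List.Relation.Unary.Unique.Propositional.Properties as Unique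
open import Data.Vec using ([]; _∷_)
import Data.Vec as Vec
open import Data.Vec.Relation.Binary.Pointwise.Inductive using ([]; _∷_)
open import Data.Product using (Σ; _×_; _,_)
open import Data.Sum using (inj₁; inj₂)
open import Data.Empty using (⊥-elim)
open import Relation.Binary.PropositionalEquality
open import Relation.Nullary using (¬_; Dec)
open import Relation.Nullary.Decidable using (_×-dec_; dec-false)

deg-mono : ∀ {r} {m m' : Monomial r} → m ∣ₘ m' → deg m ≤ deg m'
deg-mono []         = z≤n
deg-mono (a≤b ∷ ps) = +-mono-≤ a≤b (deg-mono ps)

module _ {r : ℕ} where

  countDeg-++ : ∀ (xs ys : List (Monomial r)) i →
                countDeg (xs ++ ys) i ≡ countDeg xs i + countDeg ys i
  countDeg-++ xs ys i = trans (cong length (filter-++ (λ m → deg m ≟ i) xs ys))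
                              (length-++ (filter (λ m → deg m ≟ i) xs))

  countDeg-all : ∀ (xs : List (Monomial r)) i →
                 (∀ {x} → x ∈ xs → deg x ≡ i) → countDeg xs i ≡ length xs
  countDeg-all xs i degs = cong length (filter-all (λ m → deg m ≟ i) (All.tabulate degs))

  countDeg-none : ∀ (xs : List (Monomial r)) i →
                  (∀ {x} → x ∈ xs → deg x ≢ i) → countDeg xs i ≡ 0
  countDeg-none xs i degs = cong length (filter-none (λ m → deg m ≟ i) (All.tabulate degs))

module Graded {r : ℕ} (ℓ : ℕ → List (Monomial r))
              (homogeneous : ∀ i {x} → x ∈ ℓ i → deg x ≡ i) where

  upToDegree : ℕ → List (Monomial r)
  upToDegree zero    = ℓ zero
  upToDegree (suc m) = upToDegree m ++ ℓ (suc m)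

  layer-of : ∀ {i x} → x ∈ ℓ i → deg x ≤ i × x ∈ ℓ (deg x)
  layer-of {i} x∈ = ≤-reflexive (homogeneous i x∈) , subst (λ j → _ ∈ ℓ j) (sym (homogeneous i x∈)) x∈

  ∈-upToDegree⁻ : ∀ m {x} → x ∈ upToDegree m → deg x ≤ m × x ∈ ℓ (deg x)
  ∈-upToDegree⁻ zero    x∈ = layer-of x∈
  ∈-upToDegree⁻ (suc m) x∈ with ∈-++⁻ (upToDegree m) x∈
  ... | inj₁ x∈low = let deg≤m , x∈ℓ = ∈-upToDegree⁻ m x∈low in m≤n⇒m≤1+n deg≤m , x∈ℓ
  ... | inj₂ x∈top = layer-of x∈top

  ∈-upToDegree⁺ : ∀ m {j x} → j ≤ m → x ∈ ℓ j → x ∈ upToDegree m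
  ∈-upToDegree⁺ zero    z≤n  x∈ = x∈
  ∈-upToDegree⁺ (suc m) j≤1+m x∈ with m≤n⇒m<n∨m≡n j≤1+m
  ... | inj₁ j≤m = ∈-++⁺ˡ (∈-upToDegree⁺ m (≤-pred j≤m) x∈)
  ... | inj₂ refl = ∈-++⁺ʳ (upToDegree m) x∈

  deg-upToDegree : ∀ m {x} → x ∈ upToDegree m → deg x ≤ m
  deg-upToDegree m x∈ = let deg≤ , _ = ∈-upToDegree⁻ m x∈ in deg≤

  -- layers in different degrees are disjoint, so duplicate-freeness is layerwise
  unique-upToDegree : (∀ i → Unique (ℓ i)) → ∀ m → Unique (upToDegree m)
  unique-upToDegree uniq zero    = uniq zero
  unique-upToDegree uniq (suc m) =
    Unique.++⁺ (unique-upToDegree uniq m) (uniq (suc m))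
      (λ (x∈low , x∈top) → 1+n≰n (subst (_≤ m) (homogeneous (suc m) x∈top) (deg-upToDegree m x∈low)))

  countDeg-upToDegree : ∀ m {j} → j ≤ m → countDeg (upToDegree m) j ≡ length (ℓ j)
  countDeg-upToDegree zero {zero} z≤n = countDeg-all (ℓ 0) 0 (homogeneous 0)
  countDeg-upToDegree (suc m) {j} j≤1+m with m≤n⇒m<n∨m≡n j≤1+m
  ... | inj₁ j≤m = begin
    countDeg (upToDegree m ++ ℓ (suc m)) j
      ≡⟨ countDeg-++ (upToDegree m) (ℓ (suc m)) j ⟩
    countDeg (upToDegree m) j + countDeg (ℓ (suc m)) j
      ≡⟨ cong₂ _+_ (countDeg-upToDegree m (≤-pred j≤m)) top ⟩
    length (ℓ j) + 0
      ≡⟨ +-identityʳ _ ⟩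
    length (ℓ j) ∎
    where
    open ≡-Reasoning
    top : countDeg (ℓ (suc m)) j ≡ 0
    top = countDeg-none (ℓ (suc m)) j
            (λ x∈ deg≡j → <⇒≢ j≤m (trans (sym deg≡j) (homogeneous (suc m) x∈)))
  ... | inj₂ refl = begin
    countDeg (upToDegree m ++ ℓ (suc m)) (suc m)
      ≡⟨ countDeg-++ (upToDegree m) (ℓ (suc m)) (suc m) ⟩
    countDeg (upToDegree m) (suc m) + countDeg (ℓ (suc m)) (suc m)
      ≡⟨ cong₂ _+_ low (countDeg-all (ℓ (suc m)) (suc m) (homogeneous (suc m))) ⟩
    length (ℓ (suc m)) ∎
    where
    open ≡-Reasoning
    low : countDeg (upToDegree m) (suc m) ≡ 0
    low = countDeg-none (upToDegree m) (suc m)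
            (λ x∈ deg≡ → 1+n≰n (subst (_≤ m) deg≡ (deg-upToDegree m x∈)))

maximal-degree : ∀ {r} {L : List (Monomial r)} e →
  (∀ {m} → m ∈ L → deg m ≤ e) →
  (∀ {m} → m ∈ L → deg m < e → Σ (Monomial r) λ m' → m' ∈ L × m ∣ₘ m' × deg m' ≡ suc (deg m)) →
  ∀ m → Maximal L m → deg m ≡ e
maximal-degree e bounded extend m (m∈L , maximal) with m≤n⇒m<n∨m≡n (bounded m∈L)
... | inj₂ deg≡e = deg≡e
... | inj₁ deg<e with extend m∈L deg<e
...   | m' , m'∈L , m∣m' , deg≡ = ⊥-elim (1+n≢n (trans (sym deg≡) (cong deg (maximal m'∈L m∣m'))))

-- The list of all monomials of degree d in k variables, without repetitions:
-- in degree d+1, either the first exponent is positive (raise it on a monomial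
-- of degree d) or it is zero (a monomial of degree d+1 in the other variables).
raiseFirst : ∀ {k} → Monomial (suc k) → Monomial (suc k)
raiseFirst (a ∷ w) = suc a ∷ w

monomials : (k d : ℕ) → List (Monomial k)
monomials zero    zero    = [] ∷ []
monomials zero    (suc d) = []
monomials (suc k) zero    = map (0 ∷_) (monomials k zero)
monomials (suc k) (suc d) = map raiseFirst (monomials (suc k) d) ++ map (0 ∷_) (monomials k (suc d))

deg-monomials : ∀ k d {w} → w ∈ monomials k d → deg w ≡ d
deg-monomials zero    zero    (here refl) = refl
deg-monomials (suc k) zero    w∈ with ∈-map⁻ (0 ∷_) w∈
... | _ , v∈ , refl = deg-monomials k zero v∈
deg-monomials (suc k) (suc d) w∈ with ∈-++⁻ (map raiseFirst (monomials (suc k) d)) w∈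
... | inj₁ w∈raised with ∈-map⁻ raiseFirst w∈raised
...   | _ ∷ _ , v∈ , refl = cong suc (deg-monomials (suc k) d v∈)
deg-monomials (suc k) (suc d) w∈ | inj₂ w∈zero with ∈-map⁻ (0 ∷_) w∈zero
...   | _ , v∈ , refl = deg-monomials k (suc d) v∈

∈-monomials : ∀ k (w : Monomial k) → w ∈ monomials k (deg w)
∈-monomials zero    []          = here refl
∈-monomials (suc k) (suc a ∷ w) =
  ∈-++⁺ˡ (∈-map⁺ raiseFirst (∈-monomials (suc k) (a ∷ w)))
∈-monomials (suc k) (zero ∷ w) with deg w | ∈-monomials k w
... | zero  | w∈ = ∈-map⁺ (0 ∷_) w∈
... | suc d | w∈ = ∈-++⁺ʳ (map raiseFirst (monomials (suc k) d)) (∈-map⁺ (0 ∷_) w∈)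

unique-monomials : ∀ k d → Unique (monomials k d)
unique-monomials zero    zero    = All.[] ∷ []
unique-monomials zero    (suc d) = []
unique-monomials (suc k) zero    = Unique.map⁺ (λ { refl → refl }) (unique-monomials k zero)
unique-monomials (suc k) (suc d) =
  Unique.++⁺ (Unique.map⁺ raise-injective (unique-monomials (suc k) d))
             (Unique.map⁺ (λ { refl → refl }) (unique-monomials k (suc d)))
             first-exponent-differs
  where
  raise-injective : ∀ {v w : Monomial (suc k)} → raiseFirst v ≡ raiseFirst w → v ≡ w
  raise-injective {_ ∷ _} {_ ∷ _} refl = refl
  first-exponent-differs : ∀ {w} →
    ¬ (w ∈ map raiseFirst (monomials (suc k) d) × w ∈ map (0 ∷_) (monomials k (suc d)))
  first-exponent-differs (w∈raised , w∈zero) with ∈-map⁻ raiseFirst w∈raised | ∈-map⁻ (0 ∷_) w∈zero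
  ... | _ ∷ _ , _ , refl | _ , _ , ()

length-monomials-step : ∀ k d →
  length (monomials (suc k) (suc d)) ≡ length (monomials (suc k) d) + length (monomials k (suc d))
length-monomials-step k d = trans (length-++ (map raiseFirst (monomials (suc k) d)))
  (cong₂ _+_ (length-map raiseFirst (monomials (suc k) d)) (length-map (0 ∷_) (monomials k (suc d))))

length-monomials₁ : ∀ d → length (monomials 1 d) ≡ 1
length-monomials₁ zero    = refl
length-monomials₁ (suc d) = trans (length-monomials-step 0 d) (trans (+-identityʳ _) (length-monomials₁ d))

length-monomials₂ : ∀ d → length (monomials 2 d) ≡ suc d
length-monomials₂ zero    = refl
length-monomials₂ (suc d) = trans (length-monomials-step 1 d)
  (trans (cong₂ _+_ (length-monomials₂ d) (length-monomials₁ (suc d))) (+-comm (suc d) 1))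

length-monomials₃ : ∀ d → length (monomials 3 (suc d)) ≡ length (monomials 3 d) + (2 + d)
length-monomials₃ d = trans (length-monomials-step 2 d) (cong (length (monomials 3 d) +_) (length-monomials₂ (suc d)))

choose-below : ∀ k d → k < d → choose k d ≡ 0
choose-below zero    (suc d) _         = refl
choose-below (suc k) (suc d) (s≤s k<d) = cong₂ _+_ (choose-below k d k<d) (choose-below k (suc d) (m≤n⇒m≤1+n k<d))

choose-diagonal : ∀ k → choose k k ≡ 1
choose-diagonal zero    = refl
choose-diagonal (suc k) = cong₂ _+_ (choose-diagonal k) (choose-below k (suc k) ≤-refl)

choose-subdiagonal : ∀ k → choose (suc k) k ≡ suc k
choose-subdiagonal zero    = refl
choose-subdiagonal (suc k) = trans (cong₂ _+_ (choose-subdiagonal k) (choose-diagonal (suc k))) (+-comm (suc k) 1)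

choose-grows : ∀ t k d → choose k d ≤ choose (t + k) d
choose-grows zero    k d       = ≤-refl
choose-grows (suc t) k zero    = ≤-refl
choose-grows (suc t) k (suc d) = ≤-trans (choose-grows t k (suc d)) (m≤n+m _ (choose (t + k) d))

-- A number n ≤ d has the d-binomial expansion C(d,d) + C(d-1,d-1) + …, so it is
-- a fixed point of the Macaulay bound: (n_(d))^1_1 = n.  First, the greedy search
-- for the top coefficient of n+1 ≤ d+1 in degree d+1 returns d+1, because
-- C(k,d+1) ≥ d+2 > n+1 for every k > d+1.
choose-above-small : ∀ d n → n ≤ d → ∀ t → ¬ (choose (suc (t + suc d)) (suc d) ≤ suc n)
choose-above-small d n n≤d t C≤ = 1+n≰n (≤-trans (s≤s (s≤s n≤d)) (≤-trans (begin
  suc (suc d)                      ≡⟨ choose-subdiagonal (suc d) ⟨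
  choose (suc (suc d)) (suc d)     ≤⟨ choose-grows t (suc (suc d)) (suc d) ⟩
  choose (t + suc (suc d)) (suc d) ≡⟨ cong (λ k → choose k (suc d)) (+-suc t (suc d)) ⟩
  choose (suc (t + suc d)) (suc d) ∎) C≤))
  where open ≤-Reasoning

top-coefficient-small : ∀ d n → n ≤ d → ∀ t → lastK (suc d) (suc n) (t + suc d) ≡ suc d
top-coefficient-small d n n≤d zero rewrite choose-diagonal (suc d) = refl
top-coefficient-small d n n≤d (suc t)
  rewrite dec-false (choose (suc (t + suc d)) (suc d) ≤? suc n) (choose-above-small d n n≤d t)
  = top-coefficient-small d n n≤d t

macaulay-small : ∀ d n → n ≤ d → macaulay d n ≡ n
macaulay-small zero    zero    _         = refl
macaulay-small (suc d) zero    _         = refl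
macaulay-small (suc d) (suc n) (s≤s n≤d)
  rewrite top-coefficient-small d n n≤d (suc n) | choose-diagonal (suc (suc d)) | choose-diagonal (suc d)
  = cong suc (macaulay-small d n n≤d)

at-upTo : ∀ (f : ℕ → ℕ) {n i} → i < n → at (map f (upTo n)) i ≡ f i
at-upTo f {n} i<n = trans (cong (λ h → at h _) (map-upTo f n)) (at-applyUpTo f i<n)
  where
  at-applyUpTo : ∀ (g : ℕ → ℕ) {n i} → i < n → at (applyUpTo g n) i ≡ g i
  at-applyUpTo g {suc n} {zero}  _         = refl
  at-applyUpTo g {suc n} {suc i} (s≤s i<n) = at-applyUpTo (λ j → g (suc j)) i<n

at-diffSeq : ∀ h i → suc i < length h → at (diffSeq h) (suc i) ≡ at h (suc i) ∸ at h i
at-diffSeq (x ∷ [])     zero    (s≤s ())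
at-diffSeq (x ∷ y ∷ ys) zero    _         = refl
at-diffSeq (x ∷ y ∷ ys) (suc i) (s≤s i<n) = at-diffSeq (y ∷ ys) i i<n

length-diffSeq : ∀ h → length (diffSeq h) ≡ length h
length-diffSeq []           = refl
length-diffSeq (x ∷ [])     = refl
length-diffSeq (x ∷ y ∷ ys) = cong suc (length-diffSeq (y ∷ ys))

module Example (k : ℕ) where

  n e : ℕ
  n = 2 + k
  e = 2 + n

  mk : ℕ → ℕ → ℕ → ℕ → ℕ → Monomial 5
  mk a b c s t = a ∷ b ∷ c ∷ s ∷ t ∷ []

  -- u^s v^t is a monomial of the box other than 1
  InBox : ℕ → ℕ → Set
  InBox s t = s ≤ n × t ≤ 2 × 1 ≤ s + t

  -- the monomials of I, ignoring the bound deg ≤ e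
  data Shape : Monomial 5 → Set where
    xyz : ∀ a b c → Shape (mk a b c 0 0)
    uv  : ∀ {s t} → InBox s t → Shape (mk 0 0 0 s t)

  deg-uv : ∀ s t → deg (mk 0 0 0 s t) ≡ s + t
  deg-uv s t = cong (s +_) (+-identityʳ t)

  -- Shape is closed under divisors; only 1 leaves the box, to the x,y,z-part
  shape-divisor : ∀ {m m'} → m' ∣ₘ m → Shape m → Shape m'
  shape-divisor (_ ∷ _ ∷ _ ∷ z≤n ∷ z≤n ∷ []) (xyz a b c) = xyz _ _ _
  shape-divisor (z≤n ∷ z≤n ∷ z≤n ∷ s'≤s ∷ t'≤t ∷ []) (uv {s} {t} (s≤n , t≤2 , _)) =
    divisor-of-box _ _ s'≤s t'≤t
    where
    divisor-of-box : ∀ s' t' → s' ≤ s → t' ≤ t → Shape (mk 0 0 0 s' t')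
    divisor-of-box zero     zero     _     _     = xyz 0 0 0
    divisor-of-box (suc s') t'       s'≤s  t'≤t  = uv (≤-trans s'≤s s≤n , ≤-trans t'≤t t≤2 , s≤s z≤n)
    divisor-of-box zero     (suc t') s'≤s  t'≤t  = uv (≤-trans s'≤s s≤n , ≤-trans t'≤t t≤2 , s≤s z≤n)

  -- below degree e every monomial of I has a multiple in I of one degree more:
  -- multiply by x, by v (while t < 2), or by u (when t = 2, since then s < n)
  shape-extend : ∀ {m} → Shape m → deg m < e →
                 Σ (Monomial 5) λ m' → Shape m' × m ∣ₘ m' × deg m' ≡ suc (deg m)
  shape-extend (xyz a b c) _ =
    mk (suc a) b c 0 0 , xyz _ _ _ , n≤1+n a ∷ ≤-refl ∷ ≤-refl ∷ ≤-refl ∷ ≤-refl ∷ [] , refl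
  shape-extend (uv {s} {0} (s≤n , _ , _)) _ =
    mk 0 0 0 s 1 , uv (s≤n , s≤s z≤n , ≤-trans (s≤s z≤n) (m≤n+m 1 s))
      , ≤-refl ∷ ≤-refl ∷ ≤-refl ∷ ≤-refl ∷ z≤n ∷ [] , +-suc s 0
  shape-extend (uv {s} {1} (s≤n , _ , _)) _ =
    mk 0 0 0 s 2 , uv (s≤n , ≤-refl , ≤-trans (s≤s z≤n) (m≤n+m 2 s))
      , ≤-refl ∷ ≤-refl ∷ ≤-refl ∷ ≤-refl ∷ s≤s z≤n ∷ [] , +-suc s 1
  shape-extend (uv {s} {2} _) deg<e =
    mk 0 0 0 (suc s) 2 , uv (s<n , ≤-refl , s≤s z≤n)
      , ≤-refl ∷ ≤-refl ∷ ≤-refl ∷ n≤1+n s ∷ ≤-refl ∷ [] , refl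
    where
    s<n : suc s ≤ n
    s<n = ≤-pred (≤-pred (subst (_≤ e) (cong suc (+-comm s 2)) deg<e))
  shape-extend (uv {t = suc (suc (suc _))} (_ , s≤s (s≤s ()) , _)) _

  xyzPart : Monomial 3 → Monomial 5
  xyzPart (a ∷ b ∷ c ∷ []) = mk a b c 0 0

  -- column t meets degree i in u^(i-t) v^t when t ≤ i, i - t ≤ n and i ≠ 0
  OnColumn : ℕ → ℕ → Set
  OnColumn i t = t ≤ i × i ∸ t ≤ n × 1 ≤ i

  onColumn? : ∀ i t → Dec (OnColumn i t)
  onColumn? i t = t ≤? i ×-dec (i ∸ t ≤? n ×-dec 1 ≤? i)

  columns : ℕ → List ℕ
  columns i = filter (onColumn? i) (upTo 3)

  boxLayer : ℕ → List (Monomial 5)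
  boxLayer i = map (λ t → mk 0 0 0 (i ∸ t) t) (columns i)

  layer : ℕ → List (Monomial 5)
  layer i = map xyzPart (monomials 3 i) ++ boxLayer i

  ∈-boxLayer⁻ : ∀ i {x} → x ∈ boxLayer i →
                Σ ℕ λ s → Σ ℕ λ t → x ≡ mk 0 0 0 s t × InBox s t × s + t ≡ i
  ∈-boxLayer⁻ i x∈ with ∈-map⁻ _ x∈
  ... | t , t∈ , refl with ∈-filter⁻ (onColumn? i) t∈
  ...   | t∈upTo , t≤i , i∸t≤n , 1≤i =
    i ∸ t , t , refl
      , (i∸t≤n , ≤-pred (∈-upTo⁻ t∈upTo) , subst (1 ≤_) (sym (m∸n+n≡m t≤i)) 1≤i)
      , m∸n+n≡m t≤i

  ∈-boxLayer⁺ : ∀ {s t} → InBox s t → mk 0 0 0 s t ∈ boxLayer (s + t)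
  ∈-boxLayer⁺ {s} {t} (s≤n , t≤2 , 1≤s+t) =
    subst (λ a → mk 0 0 0 a t ∈ boxLayer (s + t)) (m+n∸n≡m s t)
      (∈-map⁺ _ (∈-filter⁺ (onColumn? (s + t)) (∈-upTo⁺ (s≤s t≤2))
        (m≤n+m t s , subst (_≤ n) (sym (m+n∸n≡m s t)) s≤n , 1≤s+t)))

  ∈-layer⁻ : ∀ i {x} → x ∈ layer i → Shape x × deg x ≡ i
  ∈-layer⁻ i x∈ with ∈-++⁻ (map xyzPart (monomials 3 i)) x∈
  ... | inj₁ x∈xyz with ∈-map⁻ xyzPart x∈xyz
  ...   | a ∷ b ∷ c ∷ [] , w∈ , refl = xyz a b c , deg-monomials 3 i w∈
  ∈-layer⁻ i x∈ | inj₂ x∈box with ∈-boxLayer⁻ i x∈box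
  ...   | s , t , refl , box , s+t≡i = uv box , trans (deg-uv s t) s+t≡i

  ∈-layer⁺ : ∀ {x} → Shape x → x ∈ layer (deg x)
  ∈-layer⁺ (xyz a b c) = ∈-++⁺ˡ (∈-map⁺ xyzPart (∈-monomials 3 (a ∷ b ∷ c ∷ [])))
  ∈-layer⁺ (uv {s} {t} box) =
    subst (λ j → mk 0 0 0 s t ∈ layer j) (sym (deg-uv s t))
      (∈-++⁺ʳ (map xyzPart (monomials 3 (s + t))) (∈-boxLayer⁺ box))

  homogeneous-layer : ∀ i {x} → x ∈ layer i → deg x ≡ i
  homogeneous-layer i x∈ = let _ , deg≡i = ∈-layer⁻ i x∈ in deg≡i

  -- the two parts of a layer are disjoint since box monomials involve u or v
  unique-layer : ∀ i → Unique (layer i)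
  unique-layer i =
    Unique.++⁺ (Unique.map⁺ xyzPart-injective (unique-monomials 3 i))
               (Unique.map⁺ (cong Vec.last) (Unique.filter⁺ (onColumn? i) (Unique.upTo⁺ 3)))
               xyz-not-in-box
    where
    xyzPart-injective : ∀ {v w} → xyzPart v ≡ xyzPart w → v ≡ w
    xyzPart-injective {_ ∷ _ ∷ _ ∷ []} {_ ∷ _ ∷ _ ∷ []} refl = refl
    xyz-not-in-box : ∀ {x} → ¬ (x ∈ map xyzPart (monomials 3 i) × x ∈ boxLayer i)
    xyz-not-in-box (x∈xyz , x∈box) with ∈-map⁻ xyzPart x∈xyz | ∈-boxLayer⁻ i x∈box
    ... | _ ∷ _ ∷ _ ∷ [] , _ , refl | _ , _ , refl , (_ , _ , ()) , _

  open Graded layer homogeneous-layer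

  ideal : List (Monomial 5)
  ideal = upToDegree e

  ∈-ideal⁻ : ∀ {x} → x ∈ ideal → Shape x × deg x ≤ e
  ∈-ideal⁻ {x} x∈ with ∈-upToDegree⁻ e x∈
  ... | deg≤e , x∈layer with ∈-layer⁻ (deg x) x∈layer
  ...   | shape , _ = shape , deg≤e

  ∈-ideal⁺ : ∀ {x} → Shape x → deg x ≤ e → x ∈ ideal
  ∈-ideal⁺ shape deg≤e = ∈-upToDegree⁺ e deg≤e (∈-layer⁺ shape)

  ideal-orderIdeal : OrderIdeal ideal
  ideal-orderIdeal = record
    { unique   = unique-upToDegree unique-layer e
    ; nonempty = nonempty
    ; closed   = closed
    }
    where
    nonempty : ideal ≢ []
    nonempty ideal≡[] with subst (mk 0 0 0 0 0 ∈_) ideal≡[] (∈-ideal⁺ (xyz 0 0 0) z≤n)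
    ... | ()
    closed : ∀ {m m'} → m ∈ ideal → m' ∣ₘ m → m' ∈ ideal
    closed m∈ m'∣m with ∈-ideal⁻ m∈
    ... | shape , deg≤e = ∈-ideal⁺ (shape-divisor m'∣m shape) (≤-trans (deg-mono m'∣m) deg≤e)

  ideal-pure : PureOrderIdeal e ideal
  ideal-pure = ideal-orderIdeal , maximal-degree e (deg-upToDegree e) extend
    where
    extend : ∀ {m} → m ∈ ideal → deg m < e →
             Σ (Monomial 5) λ m' → m' ∈ ideal × m ∣ₘ m' × deg m' ≡ suc (deg m)
    extend m∈ deg<e with ∈-ideal⁻ m∈
    ... | shape , _ with shape-extend shape deg<e
    ...   | m' , shape' , m∣m' , deg≡ = m' , ∈-ideal⁺ shape' (subst (_≤ e) (sym deg≡) deg<e) , m∣m' , deg≡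

  hilbert : List ℕ
  hilbert = map (countDeg ideal) (upTo (suc e))

  F B : ℕ → ℕ
  F i = length (monomials 3 i)
  B i = length (columns i)

  length-hilbert : length hilbert ≡ suc e
  length-hilbert = trans (length-map (countDeg ideal) (upTo (suc e))) (length-upTo (suc e))

  hilbert-at : ∀ {i} → i ≤ e → at hilbert i ≡ F i + B i
  hilbert-at {i} i≤e = begin
    at hilbert i                                            ≡⟨ at-upTo (countDeg ideal) (s≤s i≤e) ⟩
    countDeg ideal i                                        ≡⟨ countDeg-upToDegree e i≤e ⟩
    length (map xyzPart (monomials 3 i) ++ boxLayer i)      ≡⟨ length-++ (map xyzPart (monomials 3 i)) ⟩
    length (map xyzPart (monomials 3 i)) + length (boxLayer i)
      ≡⟨ cong₂ _+_ (length-map xyzPart (monomials 3 i)) (length-map _ (columns i)) ⟩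
    F i + B i                                               ∎
    where open ≡-Reasoning

  -- No column meets degree 0, and there are only three columns.
  B-small : ∀ i → B i ≤ 2 + i
  B-small zero    = ≤-trans (≤-reflexive (cong length no-column)) z≤n
    where
    no-column : columns 0 ≡ []
    no-column = filter-none (onColumn? 0) {xs = upTo 3} (All.tabulate λ { _ (_ , _ , ()) })
  B-small (suc i) = ≤-trans (length-filter (onColumn? (suc i)) (upTo 3)) (s≤s (s≤s (s≤s z≤n)))

  B-n : B n ≡ 3
  B-n = cong length (filter-all (onColumn? n) {xs = upTo 3} (All.tabulate λ {t} t∈ →
          ≤-trans (≤-pred (∈-upTo⁻ t∈)) (m≤m+n 2 k) , m∸n≤m n t , s≤s z≤n))

  B-n+1 : B (1 + n) ≡ 2
  B-n+1 = cong length (begin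
    filter on? (0 ∷ 1 ∷ 2 ∷ []) ≡⟨ filter-reject on? {0} {1 ∷ 2 ∷ []} (λ (_ , 1+n≤n , _) → 1+n≰n 1+n≤n) ⟩
    filter on? (1 ∷ 2 ∷ [])     ≡⟨ filter-accept on? {1} {2 ∷ []} (s≤s z≤n , ≤-refl , s≤s z≤n) ⟩
    1 ∷ filter on? (2 ∷ [])     ≡⟨ cong (1 ∷_) (filter-accept on? {2} {[]} (s≤s (s≤s z≤n) , n≤1+n _ , s≤s z≤n)) ⟩
    1 ∷ 2 ∷ []                  ∎)
    where
    open ≡-Reasoning
    on? : ∀ t → Dec (OnColumn (1 + n) t)
    on? = onColumn? (1 + n)

  B-n+2 : B (2 + n) ≡ 1
  B-n+2 = cong length (begin
    filter on? (0 ∷ 1 ∷ 2 ∷ []) ≡⟨ filter-reject on? {0} {1 ∷ 2 ∷ []} (λ (_ , 2+n≤n , _) → 1+n≰n (≤-trans (n≤1+n _) 2+n≤n)) ⟩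
    filter on? (1 ∷ 2 ∷ [])     ≡⟨ filter-reject on? {1} {2 ∷ []} (λ (_ , 1+n≤n , _) → 1+n≰n 1+n≤n) ⟩
    filter on? (2 ∷ [])         ≡⟨ filter-accept on? {2} {[]} (s≤s (s≤s z≤n) , ≤-refl , s≤s z≤n) ⟩
    2 ∷ []                      ∎)
    where
    open ≡-Reasoning
    on? : ∀ t → Dec (OnColumn (2 + n) t)
    on? = onColumn? (2 + n)

  -- h grows by F(i+1) - F(i) = i + 2 ≥ B(i) - B(i+1) from degree i to i + 1.
  hilbert-nondecreasing : NonDecreasing hilbert
  hilbert-nondecreasing i 1+i<len =
    subst₂ _≤_ (sym (hilbert-at (<⇒≤ 1+i≤e))) (sym (hilbert-at 1+i≤e)) (begin
    F i + B i                     ≤⟨ +-monoʳ-≤ (F i) (B-small i) ⟩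
    F i + (2 + i)                 ≤⟨ m≤m+n (F i + (2 + i)) (B (suc i)) ⟩
    F i + (2 + i) + B (suc i)     ≡⟨ cong (_+ B (suc i)) (length-monomials₃ i) ⟨
    F (suc i) + B (suc i)         ∎)
    where
    open ≤-Reasoning
    1+i≤e : suc i ≤ e
    1+i≤e = ≤-pred (subst (suc i <_) length-hilbert 1+i<len)

  -- Where the box count drops by one, the first difference equals the degree:
  -- Δh(i+1) = (i + 2) - 1.
  difference-at-drop : ∀ i → suc i ≤ e → B i ≡ suc (B (suc i)) → at (diffSeq hilbert) (suc i) ≡ suc i
  difference-at-drop i 1+i≤e drop = begin
    at (diffSeq hilbert) (suc i)
      ≡⟨ at-diffSeq hilbert i (subst (suc i <_) (sym length-hilbert) (s≤s 1+i≤e)) ⟩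
    at hilbert (suc i) ∸ at hilbert i
      ≡⟨ cong₂ _∸_ (hilbert-at 1+i≤e) (hilbert-at (<⇒≤ 1+i≤e)) ⟩
    (F (suc i) + b) ∸ (F i + B i)
      ≡⟨ cong₂ (λ f b' → (f + b) ∸ (F i + b')) (length-monomials₃ i) drop ⟩
    (F i + (2 + i) + b) ∸ (F i + suc b)
      ≡⟨ cong (_∸ (F i + suc b)) (regroup (F i) i b) ⟩
    (F i + suc b + suc i) ∸ (F i + suc b)
      ≡⟨ m+n∸m≡n (F i + suc b) (suc i) ⟩
    suc i ∎
    where
    open ≡-Reasoning
    b : ℕ
    b = B (suc i)
    regroup : ∀ f i b → f + (2 + i) + b ≡ f + suc b + suc i
    regroup = solve-∀

  -- Δh(n+1) = n+1 is its own Macaulay bound in degree n+1, but Δh(n+2) = n+2.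
  hilbert-not-differentiable : ¬ Differentiable hilbert
  hilbert-not-differentiable (_ , _ , macaulay-bound) = 1+n≰n (begin
    suc (suc n)                                     ≡⟨ Δ[n+2] ⟨
    at (diffSeq hilbert) (suc (suc n))              ≤⟨ macaulay-bound (suc n) (s≤s z≤n) 2+n<len ⟩
    macaulay (suc n) (at (diffSeq hilbert) (suc n)) ≡⟨ cong (macaulay (suc n)) Δ[n+1] ⟩
    macaulay (suc n) (suc n)                        ≡⟨ macaulay-small (suc n) (suc n) ≤-refl ⟩
    suc n                                           ∎)
    where
    open ≤-Reasoning
    2+n<len : suc (suc n) < length (diffSeq hilbert)
    2+n<len = subst (suc (suc n) <_) (sym (trans (length-diffSeq hilbert) length-hilbert)) ≤-refl
    Δ[n+1] : at (diffSeq hilbert) (suc n) ≡ suc n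
    Δ[n+1] = difference-at-drop n (n≤1+n _) (trans B-n (cong suc (sym B-n+1)))
    Δ[n+2] : at (diffSeq hilbert) (suc (suc n)) ≡ suc (suc n)
    Δ[n+2] = difference-at-drop (suc n) ≤-refl (trans B-n+1 (cong suc (sym B-n+2)))

proposition3p5 : (e : ℕ) → 4 ≤ e →
    Σ (List ℕ) λ h → PureOSequence e h × NonDecreasing h × ¬ Differentiable h
proposition3p5 .(4 + k) (s≤s (s≤s (s≤s (s≤s {n = k} _)))) =
  hilbert , (5 , ideal , ideal-pure , refl) , hilbert-nondecreasing , hilbert-not-differentiable
  where open Example k
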